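{- Let $H$ be a graph and let $R$ be an $n$-ary relation over $V_H$. Suppose that $\mathrm{pPol}(E_H)\subseteq \mathrm{pPol}(R)$ and that there exists an $R$-wall for $H$. Then $\textsc{Csp}(R)$ is trivial.
   Context: Graphs are finite, simple, undirected, loopless with edge relation $E_H$. For a relation $R\subseteq V^n$, a partial function $f:\mathrm{dom}(f)\to V$, $\mathrm{dom}(f)\subseteq V^m$, is a partial polymorphism of $R$ if for every $n\times m$ matrix over $V$ with all columns in $R$ and all rows in $\mathrm{dom}(f)$, applying $f$ row-wise yields a column in $R$; $\mathrm{pPol}(R)$ is the set of these. For integers $n,m\ge1$, an $n\times m$ matrix $M=(M_{i,j})$ over $V_H$ is an $R$-wall for $H$ if (1) for every $j\in[m]$, $(M_{1,j},\dots,M_{n,j})\in R$, and (2) for all $(i,i')\in[n]^2$ there is $j\in[m]$ with $(M_{i,j},M_{i',j})\notin E_H$. $\textsc{Csp}(R)$ is the problem of deciding, given variables and constraints of the form $R(\mathbf{x})$, whether an assignment of values in $V_H$ satisfies all constraints; it is trivial if every instance is satisfiable. -}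

module Defs where

open import Level using (0ℓ)
open import Data.Nat using (ℕ; _≤_)
open import Data.Fin using (Fin)
open import Data.Product using (Σ; _×_)
open import Data.List using (List)
open import Data.List.Relation.Unary.All using (All)
open import Relation.Nullary using (¬_)
open import Function using (_∘_)

record Graph : Set₁ where
  field
    size : ℕ
    E    : Fin size → Fin size → Set
    sym  : ∀ {x y} → E x y → E y x
    irr  : ∀ {x} → ¬ E x x

Rel : Set → ℕ → Set₁
Rel V n = (Fin n → V) → Set

record PartialFun (V : Set) (m : ℕ) : Set₁ where
  field
    dom : (Fin m → V) → Set
    app : (x : Fin m → V) → dom x → V
open PartialFun public

-- f is a partial polymorphism of R: for every n×m matrix A (A i j, row i,
-- column j) with all columns in R and all rows in dom f, applying f row-wise
-- gives a tuple in R.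
IsPPol : {V : Set} {n m : ℕ} → Rel V n → PartialFun V m → Set
IsPPol {V} {n} {m} R f =
  (A : Fin n → Fin m → V) →
  (∀ j → R (λ i → A i j)) →
  (d : ∀ i → dom f (A i)) →
  R (λ i → app f (A i) (d i))

EdgeRel : (H : Graph) → Rel (Fin (Graph.size H)) 2
EdgeRel H t = Graph.E H (t Fin.zero) (t (Fin.suc Fin.zero))
  where import Data.Fin as Fin

PPolSubset : {V : Set} {n n' : ℕ} → Rel V n → Rel V n' → Set₁
PPolSubset {V} R S = ∀ (m : ℕ) → 1 ≤ m → (f : PartialFun V m) → IsPPol R f → IsPPol S f

IsWall : (H : Graph) {n : ℕ} → Rel (Fin (Graph.size H)) n →
         (m : ℕ) → (Fin n → Fin m → Fin (Graph.size H)) → Set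
IsWall H {n} R m M =
  (1 ≤ n) × (1 ≤ m) ×
  (∀ j → R (λ i → M i j)) ×
  (∀ i i' → Σ (Fin m) λ j → ¬ Graph.E H (M i j) (M i' j))

HasWall : (H : Graph) {n : ℕ} → Rel (Fin (Graph.size H)) n → Set
HasWall H {n} R = Σ ℕ λ m → Σ (Fin n → Fin m → Fin (Graph.size H)) λ M → IsWall H R m M

-- CSP(R) instances: a number of variables and a list of constraint scopes
-- (each scope an n-tuple of variables); satisfiable if some assignment
-- puts every scope into R.
Satisfiable : {V : Set} {n : ℕ} → Rel V n → (v : ℕ) → List (Fin n → Fin v) → Set
Satisfiable {V} R v cs = Σ (Fin v → V) λ σ → All (λ x → R (σ ∘ x)) cs

CspTrivial : {V : Set} {n : ℕ} → Rel V n → Set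
CspTrivial R = ∀ (v : ℕ) (cs : List (Fin _ → Fin v)) → Satisfiable R v cs

{-# OPTIONS --safe #-}
module Submission where

-- The partial function that is defined exactly on the rows of an R-wall M and
-- constant there is vacuously a partial polymorphism of E_H: a matrix whose
-- two rows are rows of M and whose columns are all edges cannot exist, since
-- some column of M separates any two of its rows by a non-edge. Hence the
-- function preserves R, and applying it to M, whose columns lie in R, shows
-- that R contains a constant tuple. The constant assignment then satisfies
-- every instance of Csp(R).

open import Defs
open import Data.Nat using (ℕ; suc; s≤s)
open import Data.Fin using (Fin; zero; suc)
open import Data.Product using (Σ; _,_)
open import Data.List.Relation.Unary.All using (universal)
open import Data.Empty using (⊥-elim)
open import Relation.Nullary using (¬_)
open import Relation.Binary.PropositionalEquality using (_≡_; refl; subst₂)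
open import Function using (id)

module _ {V : Set} {n m : ℕ} where

  IsRowOf : (Fin n → Fin m → V) → (Fin m → V) → Set
  IsRowOf M x = Σ (Fin n) λ i → ∀ j → x j ≡ M i j

  constOnRows : (Fin n → Fin m → V) → V → PartialFun V m
  constOnRows M c = record { dom = IsRowOf M ; app = λ _ _ → c }

  constOnRows-const∈ : (R : Rel V n) (M : Fin n → Fin m → V) {c : V} →
    IsPPol R (constOnRows M c) → (∀ j → R (λ i → M i j)) → R (λ _ → c)
  constOnRows-const∈ R M preserves columns∈R =
    preserves M columns∈R (λ i → i , λ _ → refl)

NonAdjacentRows : (H : Graph) {n m : ℕ} →
  (Fin n → Fin m → Fin (Graph.size H)) → Set
NonAdjacentRows H {n} {m} M =
  ∀ i i' → Σ (Fin m) λ j → ¬ Graph.E H (M i j) (M i' j)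

nonAdjacentRows⇒isPPol-edges : (H : Graph) {n m : ℕ}
  {M : Fin n → Fin m → Fin (Graph.size H)} → NonAdjacentRows H M →
  (f : PartialFun (Fin (Graph.size H)) m) →
  (∀ {x} → dom f x → IsRowOf M x) → IsPPol (EdgeRel H) f
nonAdjacentRows⇒isPPol-edges H separated f dom⊆rows A columns∈E rows∈dom
  with dom⊆rows (rows∈dom zero) | dom⊆rows (rows∈dom (suc zero))
... | i , A₀≡Mi | i' , A₁≡Mi' with separated i i'
... | j , nonEdge =
  ⊥-elim (nonEdge (subst₂ (Graph.E H) (A₀≡Mi j) (A₁≡Mi' j) (columns∈E j)))

const∈⇒cspTrivial : {V : Set} {n : ℕ} (R : Rel V n) {c : V} →
  R (λ _ → c) → CspTrivial R
const∈⇒cspTrivial R {c} const∈R v cs = (λ _ → c) , universal (λ _ → const∈R) cs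

lemma3p4 : (H : Graph) (n : ℕ) (R : Rel (Fin (Graph.size H)) n) →
    PPolSubset (EdgeRel H) R → HasWall H R → CspTrivial R
lemma3p4 H _ R pPolE⊆pPolR
         (suc m , M , s≤s _ , 1≤m , columns∈R , separated) =
  const∈⇒cspTrivial R (constOnRows-const∈ R M preservesR columns∈R)
  where
  f : PartialFun (Fin (Graph.size H)) (suc m)
  f = constOnRows M (M zero zero)
  preservesR : IsPPol R f
  preservesR = pPolE⊆pPolR (suc m) 1≤m f
    (nonAdjacentRows⇒isPPol-edges H separated f id)
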